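{- Let $\mathcal{H}$ be a pre-Hilbert category and $X$ an object. Then $\mathrm{ClSub}(X)$ is a lattice. Explicitly, the join of $m:M\to X$ and $n:N\to X$ is $\mathrm{Im}([m,n])$, where $[m,n]:M\oplus N\to X$ is the cotuple, and the least element is represented by $0\to X$.
   Context: A $\dagger$-category is a category $\mathcal{H}$ with a functor $\dagger:\mathcal{H}^{\mathrm{op}}\to\mathcal{H}$ that is the identity on objects with $f^{\dagger\dagger}=f$. A morphism $m$ is a $\dagger$-mono if $m^\dagger m=\mathrm{id}$, a $\dagger$-epi if $mm^\dagger=\mathrm{id}$. A pre-Hilbert category is a $\dagger$-category such that: it has finite $\dagger$-biproducts (finite biproducts, including a zero object $0$, with $\pi^\dagger=\kappa$); it has finite $\dagger$-equalisers (equalisers that are $\dagger$-monos); every $\dagger$-mono is a kernel of some morphism; and it is symmetric $\dagger$-monoidal ($(f\otimes g)^\dagger=f^\dagger\otimes g^\dagger$, coherence isomorphisms $\dagger$-isos). A subobject of $X$ is an equivalence class of monos into $X$ (modulo isomorphism of domains commuting with the monos), ordered by $M\le N$ iff $m=nf$ for some $f$; $\mathrm{ClSub}(X)$ is the poset of subobjects representable by a $\dagger$-mono. Every morphism $h$ factors as $h=me$ with $e$ epi and $m$ a $\dagger$-mono, uniquely up to $\dagger$-iso; $\mathrm{Im}(h)$ denotes the element of $\mathrm{ClSub}$ represented by $m$. -}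

module Defs where

open import Level using (Level; _⊔_) renaming (suc to lsuc)
open import Relation.Binary.PropositionalEquality using (_≡_)
open import Data.Product using (Σ; _×_; _,_)

record PreHilbert (o h : Level) : Set (lsuc (o ⊔ h)) where
  infixr 9 _∘_
  infixr 6 _⊕_
  infixr 7 _⊗₀_ _⊗₁_
  field
    Obj : Set o
    Hom : Obj → Obj → Set h
    id  : ∀ {A} → Hom A A
    _∘_ : ∀ {A B C} → Hom B C → Hom A B → Hom A C
    identityˡ : ∀ {A B} {f : Hom A B} → id ∘ f ≡ f
    identityʳ : ∀ {A B} {f : Hom A B} → f ∘ id ≡ f
    assoc : ∀ {A B C D} {f : Hom A B} {g : Hom B C} {k : Hom C D} →
            (k ∘ g) ∘ f ≡ k ∘ (g ∘ f)
    _† : ∀ {A B} → Hom A B → Hom B A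
    †-identity : ∀ {A} → (id {A}) † ≡ id
    †-homomorphism : ∀ {A B C} {f : Hom A B} {g : Hom B C} → (g ∘ f) † ≡ (f †) ∘ (g †)
    †-involutive : ∀ {A B} {f : Hom A B} → (f †) † ≡ f
    𝟘 : Obj
    ¡ : ∀ {A} → Hom 𝟘 A
    ¡-unique : ∀ {A} (f : Hom 𝟘 A) → f ≡ ¡
    ! : ∀ {A} → Hom A 𝟘
    !-unique : ∀ {A} (f : Hom A 𝟘) → f ≡ !

  zero : ∀ {A B} → Hom A B
  zero = ¡ ∘ !

  IsDaggerMono : ∀ {A B} → Hom A B → Set h
  IsDaggerMono m = (m †) ∘ m ≡ id

  IsDaggerEpi : ∀ {A B} → Hom A B → Set h
  IsDaggerEpi m = m ∘ (m †) ≡ id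

  IsDaggerIso : ∀ {A B} → Hom A B → Set h
  IsDaggerIso m = IsDaggerMono m × IsDaggerEpi m

  IsEqualiser : ∀ {E A B} → Hom A B → Hom A B → Hom E A → Set (o ⊔ h)
  IsEqualiser {E} {A} f g e =
    (f ∘ e ≡ g ∘ e) ×
    (∀ {Z} (k : Hom Z A) → f ∘ k ≡ g ∘ k →
       Σ (Hom Z E) (λ u → (e ∘ u ≡ k) × (∀ (v : Hom Z E) → e ∘ v ≡ k → v ≡ u)))

  IsKernel : ∀ {M X Y} → Hom X Y → Hom M X → Set (o ⊔ h)
  IsKernel f m = IsEqualiser f zero m

  field
    -- finite dagger biproducts (binary ones; the nullary one is 𝟘)
    _⊕_ : Obj → Obj → Obj
    π₁ : ∀ {A B} → Hom (A ⊕ B) A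
    π₂ : ∀ {A B} → Hom (A ⊕ B) B
    ⟨_,_⟩ : ∀ {C A B} → Hom C A → Hom C B → Hom C (A ⊕ B)
    π₁∘⟨⟩ : ∀ {C A B} {f : Hom C A} {g : Hom C B} → π₁ ∘ ⟨ f , g ⟩ ≡ f
    π₂∘⟨⟩ : ∀ {C A B} {f : Hom C A} {g : Hom C B} → π₂ ∘ ⟨ f , g ⟩ ≡ g
    ⟨⟩-unique : ∀ {C A B} {f : Hom C A} {g : Hom C B} {k : Hom C (A ⊕ B)} →
                π₁ ∘ k ≡ f → π₂ ∘ k ≡ g → k ≡ ⟨ f , g ⟩
    κ₁ : ∀ {A B} → Hom A (A ⊕ B)
    κ₂ : ∀ {A B} → Hom B (A ⊕ B)
    [_,_] : ∀ {A B C} → Hom A C → Hom B C → Hom (A ⊕ B) C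
    []∘κ₁ : ∀ {A B C} {f : Hom A C} {g : Hom B C} → [ f , g ] ∘ κ₁ ≡ f
    []∘κ₂ : ∀ {A B C} {f : Hom A C} {g : Hom B C} → [ f , g ] ∘ κ₂ ≡ g
    []-unique : ∀ {A B C} {f : Hom A C} {g : Hom B C} {k : Hom (A ⊕ B) C} →
                k ∘ κ₁ ≡ f → k ∘ κ₂ ≡ g → k ≡ [ f , g ]
    π₁∘κ₁ : ∀ {A B} → π₁ ∘ κ₁ {A} {B} ≡ id
    π₂∘κ₂ : ∀ {A B} → π₂ ∘ κ₂ {A} {B} ≡ id
    π₁∘κ₂ : ∀ {A B} → π₁ ∘ κ₂ {A} {B} ≡ zero
    π₂∘κ₁ : ∀ {A B} → π₂ ∘ κ₁ {A} {B} ≡ zero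
    π₁†≡κ₁ : ∀ {A B} → (π₁ {A} {B}) † ≡ κ₁
    π₂†≡κ₂ : ∀ {A B} → (π₂ {A} {B}) † ≡ κ₂
    equaliser : ∀ {A B} (f g : Hom A B) →
                Σ Obj (λ E → Σ (Hom E A) (λ e → IsEqualiser f g e × IsDaggerMono e))
    daggerMono⇒kernel : ∀ {M X} (m : Hom M X) → IsDaggerMono m →
                        Σ Obj (λ Y → Σ (Hom X Y) (λ f → IsKernel f m))
    _⊗₀_ : Obj → Obj → Obj
    _⊗₁_ : ∀ {A B C D} → Hom A B → Hom C D → Hom (A ⊗₀ C) (B ⊗₀ D)
    ⊗-identity : ∀ {A B} → id {A} ⊗₁ id {B} ≡ id
    ⊗-homomorphism : ∀ {A B C D E F} {f : Hom A B} {f' : Hom B C} {g : Hom D E} {g' : Hom E F} →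
                     (f' ∘ f) ⊗₁ (g' ∘ g) ≡ (f' ⊗₁ g') ∘ (f ⊗₁ g)
    ⊗-† : ∀ {A B C D} {f : Hom A B} {g : Hom C D} → (f ⊗₁ g) † ≡ (f †) ⊗₁ (g †)
    I : Obj
    α : ∀ {A B C} → Hom ((A ⊗₀ B) ⊗₀ C) (A ⊗₀ (B ⊗₀ C))
    λ⊗ : ∀ {A} → Hom (I ⊗₀ A) A
    ρ⊗ : ∀ {A} → Hom (A ⊗₀ I) A
    σ : ∀ {A B} → Hom (A ⊗₀ B) (B ⊗₀ A)
    α-daggerIso : ∀ {A B C} → IsDaggerIso (α {A} {B} {C})
    λ-daggerIso : ∀ {A} → IsDaggerIso (λ⊗ {A})
    ρ-daggerIso : ∀ {A} → IsDaggerIso (ρ⊗ {A})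
    σ-daggerIso : ∀ {A B} → IsDaggerIso (σ {A} {B})
    α-natural : ∀ {A A' B B' C C'} {f : Hom A A'} {g : Hom B B'} {k : Hom C C'} →
                α ∘ ((f ⊗₁ g) ⊗₁ k) ≡ (f ⊗₁ (g ⊗₁ k)) ∘ α
    λ-natural : ∀ {A B} {f : Hom A B} → λ⊗ ∘ (id {I} ⊗₁ f) ≡ f ∘ λ⊗
    ρ-natural : ∀ {A B} {f : Hom A B} → ρ⊗ ∘ (f ⊗₁ id {I}) ≡ f ∘ ρ⊗
    σ-natural : ∀ {A A' B B'} {f : Hom A A'} {g : Hom B B'} →
                σ ∘ (f ⊗₁ g) ≡ (g ⊗₁ f) ∘ σ
    pentagon : ∀ {A B C D} →
               (id {A} ⊗₁ α {B} {C} {D}) ∘ (α {A} {B ⊗₀ C} {D} ∘ (α {A} {B} {C} ⊗₁ id {D}))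
               ≡ α {A} {B} {C ⊗₀ D} ∘ α {A ⊗₀ B} {C} {D}
    triangle : ∀ {A B} → (id {A} ⊗₁ λ⊗ {B}) ∘ α {A} {I} {B} ≡ ρ⊗ {A} ⊗₁ id {B}
    hexagon : ∀ {A B C} →
              α {B} {C} {A} ∘ (σ {A} {B ⊗₀ C} ∘ α {A} {B} {C})
              ≡ (id {B} ⊗₁ σ {A} {C}) ∘ (α {B} {A} {C} ∘ (σ {A} {B} ⊗₁ id {C}))
    σ-involutive : ∀ {A B} → σ {B} {A} ∘ σ {A} {B} ≡ id

module _ {o h : Level} (C : PreHilbert o h) where
  open PreHilbert C

  IsEpi : ∀ {A B} → Hom A B → Set (o ⊔ h)
  IsEpi {A} {B} e = ∀ {Z} (g k : Hom B Z) → g ∘ e ≡ k ∘ e → g ≡ k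

  -- a representative of an element of ClSub(X): a dagger mono into X
  record ClSub (X : Obj) : Set (o ⊔ h) where
    constructor clsub
    field
      dom : Obj
      arr : Hom dom X
      daggerMono : IsDaggerMono arr

  _≤ₛ_ : ∀ {X} → ClSub X → ClSub X → Set h
  a ≤ₛ b = Σ (Hom (ClSub.dom a) (ClSub.dom b)) (λ f → ClSub.arr a ≡ ClSub.arr b ∘ f)

  IsMeet : ∀ {X} → ClSub X → ClSub X → ClSub X → Set (o ⊔ h)
  IsMeet {X} a b c = (c ≤ₛ a) × (c ≤ₛ b) × (∀ (d : ClSub X) → d ≤ₛ a → d ≤ₛ b → d ≤ₛ c)

  IsJoin : ∀ {X} → ClSub X → ClSub X → ClSub X → Set (o ⊔ h)
  IsJoin {X} a b c = (a ≤ₛ c) × (b ≤ₛ c) × (∀ (d : ClSub X) → a ≤ₛ d → b ≤ₛ d → c ≤ₛ d)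

  record EpiDaggerMonoFactorisation {A X : Obj} (k : Hom A X) : Set (o ⊔ h) where
    field
      obj : Obj
      e : Hom A obj
      m : Hom obj X
      e-epi : IsEpi e
      m-daggerMono : IsDaggerMono m
      factors : m ∘ e ≡ k

  Im : ∀ {A X} {k : Hom A X} → EpiDaggerMonoFactorisation k → ClSub X
  Im F = clsub obj m m-daggerMono
    where open EpiDaggerMonoFactorisation F

  cotuple : ∀ {X} (a b : ClSub X) → Hom (ClSub.dom a ⊕ ClSub.dom b) X
  cotuple a b = [ ClSub.arr a , ClSub.arr b ]

module Submission where

-- A dagger mono m is the kernel of some f, so k factors through m as soon as every f
-- killing m kills k. Hence ker f ∧ ker g = ker ⟨ f , g ⟩. The image of k is m = ker (c †) for
-- c = ker (k †): any f killing k has f † factoring through c, so f kills m, which makes m the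
-- least closed subobject through which k = m ∘ e factors. If g ∘ e ≡ g' ∘ e, then k factors
-- through m ∘ q for the dagger equaliser q of g and g', minimality splits q, and g ≡ g'; so e
-- is epi. A closed ker f above m and n has f ∘ [ m , n ] ≡ zero, so f kills the image too.

open import Defs
open import Data.Product using (Σ; _×_; _,_; proj₁; proj₂)
open import Relation.Binary.PropositionalEquality hiding ([_])
open ≡-Reasoning

module _ {o h} (C : PreHilbert o h) where
  open PreHilbert C

  zero-∘ : ∀ {A B D} (f : Hom A B) → zero {B} {D} ∘ f ≡ zero
  zero-∘ f = trans assoc (cong (¡ ∘_) (!-unique _))

  ∘-zero : ∀ {A B D} (f : Hom B D) → f ∘ zero {A} {B} ≡ zero
  ∘-zero f = trans (sym assoc) (cong (_∘ !) (¡-unique _))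

  zero-† : ∀ {A B} → (zero {A} {B}) † ≡ zero
  zero-† = trans †-homomorphism (cong₂ _∘_ (¡-unique _) (!-unique _))

  kills-∘ʳ : ∀ {A B D E} {f : Hom B D} {m : Hom A B} (u : Hom E A) →
             f ∘ m ≡ zero → f ∘ (m ∘ u) ≡ zero
  kills-∘ʳ {f = f} {m} u fm = begin
    f ∘ (m ∘ u)  ≡⟨ sym assoc ⟩
    (f ∘ m) ∘ u  ≡⟨ cong (_∘ u) fm ⟩
    zero ∘ u     ≡⟨ zero-∘ u ⟩
    zero         ∎

  kills-∘ˡ : ∀ {A B D E} {f : Hom B D} {k : Hom A B} (g : Hom D E) →
             f ∘ k ≡ zero → (g ∘ f) ∘ k ≡ zero
  kills-∘ˡ {f = f} {k} g fk = begin
    (g ∘ f) ∘ k  ≡⟨ assoc ⟩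
    g ∘ (f ∘ k)  ≡⟨ cong (g ∘_) fk ⟩
    g ∘ zero     ≡⟨ ∘-zero g ⟩
    zero         ∎

  kills-† : ∀ {A B D} {f : Hom B D} {k : Hom A B} → f ∘ k ≡ zero → (k †) ∘ (f †) ≡ zero
  kills-† fk = trans (sym †-homomorphism) (trans (cong _† fk) zero-†)

  daggerMono-cancelˡ : ∀ {A B D} {m : Hom A B} → IsDaggerMono m →
                       {x y : Hom D A} → m ∘ x ≡ m ∘ y → x ≡ y
  daggerMono-cancelˡ {m = m} m†m {x} {y} mx≡my = begin
    x                ≡⟨ sym identityˡ ⟩
    id ∘ x           ≡⟨ cong (_∘ x) (sym m†m) ⟩
    ((m †) ∘ m) ∘ x  ≡⟨ assoc ⟩
    (m †) ∘ (m ∘ x)  ≡⟨ cong ((m †) ∘_) mx≡my ⟩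
    (m †) ∘ (m ∘ y)  ≡⟨ sym assoc ⟩
    ((m †) ∘ m) ∘ y  ≡⟨ cong (_∘ y) m†m ⟩
    id ∘ y           ≡⟨ identityˡ ⟩
    y                ∎

  daggerMono-∘ : ∀ {A B D} {m : Hom B D} {q : Hom A B} →
                 IsDaggerMono m → IsDaggerMono q → IsDaggerMono (m ∘ q)
  daggerMono-∘ {m = m} {q} m†m q†q = begin
    (m ∘ q) † ∘ (m ∘ q)        ≡⟨ cong (_∘ (m ∘ q)) †-homomorphism ⟩
    ((q †) ∘ (m †)) ∘ (m ∘ q)  ≡⟨ assoc ⟩
    (q †) ∘ ((m †) ∘ (m ∘ q))  ≡⟨ cong ((q †) ∘_) (sym assoc) ⟩
    (q †) ∘ (((m †) ∘ m) ∘ q)  ≡⟨ cong (λ z → (q †) ∘ (z ∘ q)) m†m ⟩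
    (q †) ∘ (id ∘ q)           ≡⟨ cong ((q †) ∘_) identityˡ ⟩
    (q †) ∘ q                  ≡⟨ q†q ⟩
    id                         ∎

  equaliser-factor : ∀ {E A B Z} {f g : Hom A B} {e : Hom E A} → IsEqualiser f g e →
                     (k : Hom Z A) → f ∘ k ≡ g ∘ k → Σ (Hom Z E) (λ u → k ≡ e ∘ u)
  equaliser-factor (_ , universal) k fk≡gk =
    let (u , eu≡k , _) = universal k fk≡gk in u , sym eu≡k

  equaliser-section⇒≡ : ∀ {E A B} {f g : Hom A B} {e : Hom E A} {s : Hom A E} →
                        f ∘ e ≡ g ∘ e → e ∘ s ≡ id → f ≡ g
  equaliser-section⇒≡ {f = f} {g} {e} {s} fe≡ge es≡id = begin
    f            ≡⟨ sym identityʳ ⟩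
    f ∘ id       ≡⟨ cong (f ∘_) (sym es≡id) ⟩
    f ∘ (e ∘ s)  ≡⟨ sym assoc ⟩
    (f ∘ e) ∘ s  ≡⟨ cong (_∘ s) fe≡ge ⟩
    (g ∘ e) ∘ s  ≡⟨ assoc ⟩
    g ∘ (e ∘ s)  ≡⟨ cong (g ∘_) es≡id ⟩
    g ∘ id       ≡⟨ identityʳ ⟩
    g            ∎

  kernel-kills : ∀ {M A B} {f : Hom A B} {m : Hom M A} → IsKernel f m → f ∘ m ≡ zero
  kernel-kills {m = m} (fm≡zm , _) = trans fm≡zm (zero-∘ m)

  kernel-factor : ∀ {M A B Z} {f : Hom A B} {m : Hom M A} → IsKernel f m →
                  (k : Hom Z A) → f ∘ k ≡ zero → Σ (Hom Z M) (λ u → k ≡ m ∘ u)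
  kernel-factor ker k fk = equaliser-factor ker k (trans fk (sym (zero-∘ k)))

  factor-daggerMono : ∀ {M A Z} {m : Hom M A} → IsDaggerMono m → (k : Hom Z A) →
                      (∀ {Y} (f : Hom A Y) → f ∘ m ≡ zero → f ∘ k ≡ zero) →
                      Σ (Hom Z M) (λ u → k ≡ m ∘ u)
  factor-daggerMono {m = m} m†m k kills =
    let (_ , f , ker) = daggerMono⇒kernel m m†m
    in kernel-factor ker k (kills f (kernel-kills ker))

  ⟨⟩-kills : ∀ {D A B Z} {f : Hom D A} {g : Hom D B} {k : Hom Z D} →
             f ∘ k ≡ zero → g ∘ k ≡ zero → ⟨ f , g ⟩ ∘ k ≡ zero
  ⟨⟩-kills fk gk =
    trans (⟨⟩-unique (trans (sym assoc) (trans (cong (_∘ _) π₁∘⟨⟩) fk))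
                     (trans (sym assoc) (trans (cong (_∘ _) π₂∘⟨⟩) gk)))
          (sym (⟨⟩-unique (∘-zero π₁) (∘-zero π₂)))

  ⟨⟩-kills₁ : ∀ {D A B Z} {f : Hom D A} {g : Hom D B} {k : Hom Z D} →
              ⟨ f , g ⟩ ∘ k ≡ zero → f ∘ k ≡ zero
  ⟨⟩-kills₁ {k = k} tk = trans (cong (_∘ k) (sym π₁∘⟨⟩)) (kills-∘ˡ π₁ tk)

  ⟨⟩-kills₂ : ∀ {D A B Z} {f : Hom D A} {g : Hom D B} {k : Hom Z D} →
              ⟨ f , g ⟩ ∘ k ≡ zero → g ∘ k ≡ zero
  ⟨⟩-kills₂ {k = k} tk = trans (cong (_∘ k) (sym π₂∘⟨⟩)) (kills-∘ˡ π₂ tk)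

  []-killed : ∀ {A B D Y} {f : Hom D Y} {m : Hom A D} {n : Hom B D} →
              f ∘ m ≡ zero → f ∘ n ≡ zero → f ∘ [ m , n ] ≡ zero
  []-killed fm fn =
    trans ([]-unique (trans assoc (trans (cong (_ ∘_) []∘κ₁) fm))
                     (trans assoc (trans (cong (_ ∘_) []∘κ₂) fn)))
          (sym ([]-unique (zero-∘ κ₁) (zero-∘ κ₂)))

  factor-kills : ∀ {Z M X Y} {k : Hom Z X} {m : Hom M X} {f : Hom X Y} →
                 Σ (Hom Z M) (λ u → k ≡ m ∘ u) → f ∘ m ≡ zero → f ∘ k ≡ zero
  factor-kills {f = f} (u , k≡mu) fm = trans (cong (f ∘_) k≡mu) (kills-∘ʳ u fm)

  module Image {A X} (k : Hom A X) where
    k†-kernel : Σ Obj (λ K → Σ (Hom K X) (λ c → IsKernel (k †) c × IsDaggerMono c))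
    k†-kernel = equaliser (k †) zero

    c : Hom (proj₁ k†-kernel) X
    c = proj₁ (proj₂ k†-kernel)

    c-kernel : IsKernel (k †) c
    c-kernel = proj₁ (proj₂ (proj₂ k†-kernel))

    image : Σ Obj (λ M → Σ (Hom M X) (λ m → IsKernel (c †) m × IsDaggerMono m))
    image = equaliser (c †) zero

    M : Obj
    M = proj₁ image

    m : Hom M X
    m = proj₁ (proj₂ image)

    m-kernel : IsKernel (c †) m
    m-kernel = proj₁ (proj₂ (proj₂ image))

    m-daggerMono : IsDaggerMono m
    m-daggerMono = proj₂ (proj₂ (proj₂ image))

    c†-kills-k : (c †) ∘ k ≡ zero
    c†-kills-k = trans (cong ((c †) ∘_) (sym †-involutive)) (kills-† (kernel-kills c-kernel))

    cover : Σ (Hom A M) (λ e → k ≡ m ∘ e)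
    cover = kernel-factor m-kernel k c†-kills-k

    e : Hom A M
    e = proj₁ cover

    kills-image : ∀ {Y} (f : Hom X Y) → f ∘ k ≡ zero → f ∘ m ≡ zero
    kills-image f fk with kernel-factor c-kernel (f †) (kills-† fk)
    ... | v , f†≡cv = begin
      f ∘ m                ≡⟨ cong (_∘ m) (sym †-involutive) ⟩
      (f †) † ∘ m          ≡⟨ cong (λ z → z † ∘ m) f†≡cv ⟩
      (c ∘ v) † ∘ m        ≡⟨ cong (_∘ m) †-homomorphism ⟩
      ((v †) ∘ (c †)) ∘ m  ≡⟨ kills-∘ˡ (v †) (kernel-kills m-kernel) ⟩
      zero                 ∎

    image-minimal : ∀ {N} {n : Hom N X} {u : Hom A N} → IsDaggerMono n → k ≡ n ∘ u →
                    Σ (Hom M N) (λ w → m ≡ n ∘ w)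
    image-minimal n†n k≡nu =
      factor-daggerMono n†n m λ f fn → kills-image f (factor-kills (_ , k≡nu) fn)

    e-epi : IsEpi C e
    e-epi g g' ge≡g'e =
      let (_ , q , q-equaliser , q†q) = equaliser g g'
          (u , e≡qu) = equaliser-factor q-equaliser e ge≡g'e
          (w , m≡mqw) = image-minimal (daggerMono-∘ m-daggerMono q†q)
                          (trans (proj₂ cover) (trans (cong (m ∘_) e≡qu) (sym assoc)))
          qw≡id = daggerMono-cancelˡ m-daggerMono
                    (sym (trans identityʳ (trans m≡mqw assoc)))
      in equaliser-section⇒≡ (proj₁ q-equaliser) qw≡id

    factorisation : EpiDaggerMonoFactorisation C k
    factorisation = record
      { obj = M ; e = e ; m = m ; e-epi = e-epi
      ; m-daggerMono = m-daggerMono ; factors = sym (proj₂ cover) }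

  meet : ∀ {X} (a b : ClSub C X) → Σ (ClSub C X) (λ c → IsMeet C a b c)
  meet (clsub A ma ma†ma) (clsub B mb mb†mb) =
    let (_ , f , f-kernel) = daggerMono⇒kernel ma ma†ma
        (_ , g , g-kernel) = daggerMono⇒kernel mb mb†mb
        (E , e , e-kernel , e†e) = equaliser ⟨ f , g ⟩ zero
    in clsub E e e†e
     , kernel-factor f-kernel e (⟨⟩-kills₁ (kernel-kills e-kernel))
     , kernel-factor g-kernel e (⟨⟩-kills₂ (kernel-kills e-kernel))
     , λ d d≤a d≤b → kernel-factor e-kernel (ClSub.arr d)
         (⟨⟩-kills (factor-kills d≤a (kernel-kills f-kernel)) (factor-kills d≤b (kernel-kills g-kernel)))

  join : ∀ {X} (a b : ClSub C X) (F : EpiDaggerMonoFactorisation C (cotuple C a b)) →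
         IsJoin C a b (Im C F)
  join {X} a b F = below κ₁ []∘κ₁ , below κ₂ []∘κ₂ , least
    where
    open EpiDaggerMonoFactorisation F
    below : ∀ {D} (ι : Hom D (ClSub.dom a ⊕ ClSub.dom b)) {x : Hom D X} →
            cotuple C a b ∘ ι ≡ x → Σ (Hom D obj) (λ u → x ≡ m ∘ u)
    below ι cι≡x = e ∘ ι , trans (sym cι≡x) (trans (cong (_∘ ι) (sym factors)) assoc)
    least : ∀ (d : ClSub C X) → _≤ₛ_ C a d → _≤ₛ_ C b d → _≤ₛ_ C (Im C F) d
    least (clsub D md md†md) a≤d b≤d = factor-daggerMono md†md m λ f fd →
      e-epi (f ∘ m) zero
        (trans assoc (trans (cong (f ∘_) factors)
          (trans ([]-killed (factor-kills a≤d fd) (factor-kills b≤d fd)) (sym (zero-∘ e)))))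

  ¡-daggerMono : ∀ {X} → IsDaggerMono (¡ {X})
  ¡-daggerMono = trans (¡-unique _) (sym (¡-unique id))

  ¡-least : ∀ {X} (a : ClSub C X) → _≤ₛ_ C (clsub 𝟘 ¡ ¡-daggerMono) a
  ¡-least a = ¡ , sym (¡-unique _)

proposition2 : ∀ {o h} (C : PreHilbert o h) (X : PreHilbert.Obj C) →
    (∀ (a b : ClSub C X) → Σ (ClSub C X) (λ c → IsMeet C a b c))
    × (∀ (a b : ClSub C X) → EpiDaggerMonoFactorisation C (cotuple C a b))
    × (∀ (a b : ClSub C X) (F : EpiDaggerMonoFactorisation C (cotuple C a b)) →
         IsJoin C a b (Im C F))
    × Σ (PreHilbert.IsDaggerMono C (PreHilbert.¡ C {X}))
        (λ p → ∀ (a : ClSub C X) → _≤ₛ_ C (clsub (PreHilbert.𝟘 C) (PreHilbert.¡ C) p) a)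
proposition2 C X =
    meet C
  , (λ a b → Image.factorisation C (cotuple C a b))
  , join C
  , ¡-daggerMono C , ¡-least C
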